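{- Let $p \geq 4$ be an even integer, and let $D$ be an oriented graph with at least $p + 2$ vertices and at least one directed cycle. Then $$\mathrm{inv}^{\leq p}(D) \leq \mathrm{inv}^{= p}(D) \leq (4p-4)\binom{p}{2} \mathrm{inv}^{\leq p}(D).$$
   Context: For an oriented graph $D$ and $X\subseteq V(D)$, the inversion of $X$ reverses the orientation of every arc with both endpoints in $X$. A $(=p)$-inversion (resp. $(\le p)$-inversion) is the inversion of a set of exactly (resp. at most) $p$ vertices. $\mathrm{inv}^{=p}(D)$ (resp. $\mathrm{inv}^{\le p}(D)$) is the minimum number of $(=p)$-inversions (resp. $(\le p)$-inversions) whose successive application makes $D$ acyclic, $+\infty$ if impossible. -}

module Defs where

open import Data.Bool using (Bool; true; false; if_then_else_; _∧_)
open import Data.Nat using (ℕ; zero; suc; _+_; _*_; _≤_; _<_)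
open import Data.Fin using (Fin; fromℕ; inject₁; toℕ) renaming (zero to fzero; suc to fsuc)
open import Data.Fin.Subset using (Subset; ∣_∣)
open import Data.Vec using (lookup)
open import Data.List using (List; []; _∷_; length; foldl)
open import Data.List.Relation.Unary.All using (All)
open import Data.Product using (Σ; _×_; ∃)
open import Relation.Binary.PropositionalEquality using (_≡_)
open import Relation.Nullary using (¬_)
open import Function.Definitions using (Injective)

-- A digraph on vertex set Fin n: arc u → v iff  D u v ≡ true.
Digraph : ℕ → Set
Digraph n = Fin n → Fin n → Bool

IsOriented : {n : ℕ} → Digraph n → Set
IsOriented {n} D =
  ((u : Fin n) → D u u ≡ false) ×
  ((u v : Fin n) → D u v ≡ true → D v u ≡ false)

-- Cyclic successor on Fin (suc k).
next : {k : ℕ} → Fin (suc k) → Fin (suc k)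
next {zero} _ = fzero
next {suc k} fzero = fsuc fzero
next {suc k} (fsuc i) with next {k} i
... | fzero = fzero
... | fsuc j = fsuc (fsuc j)

record DirectedCycle {n : ℕ} (D : Digraph n) : Set where
  field
    len    : ℕ
    vert   : Fin (suc len) → Fin n
    inj    : Injective _≡_ _≡_ vert
    arcs   : (i : Fin (suc len)) → D (vert i) (vert (next i)) ≡ true

Acyclic : {n : ℕ} → Digraph n → Set
Acyclic D = ¬ DirectedCycle D

invert : {n : ℕ} → Subset n → Digraph n → Digraph n
invert X D u v = if lookup X u ∧ lookup X v then D v u else D u v

invertAll : {n : ℕ} → List (Subset n) → Digraph n → Digraph n
invertAll [] D = D
invertAll (X ∷ Xs) D = invertAll Xs (invert X D)

SolvableWith : {n : ℕ} → (Subset n → Set) → Digraph n → ℕ → Set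
SolvableWith {n} P D k =
  Σ (List (Subset n)) λ Xs → (length Xs ≡ k) × All P Xs × Acyclic (invertAll Xs D)

IsMinInv : {n : ℕ} → (Subset n → Set) → Digraph n → ℕ → Set
IsMinInv P D m = SolvableWith P D m × (∀ k → SolvableWith P D k → m ≤ k)

ExactlyP : {n : ℕ} → ℕ → Subset n → Set
ExactlyP p X = ∣ X ∣ ≡ p

AtMostP : {n : ℕ} → ℕ → Subset n → Set
AtMostP p X = ∣ X ∣ ≤ p

IsInvEq : {n : ℕ} → ℕ → Digraph n → ℕ → Set
IsInvEq p D m = IsMinInv (ExactlyP p) D m

IsInvLe : {n : ℕ} → ℕ → Digraph n → ℕ → Set
IsInvLe p D m = IsMinInv (AtMostP p) D m

module Submission where

-- Inversions act through parities: after inverting X₁, …, Xₖ the arc between u ≢ v is reversed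
-- iff an odd number of the Xᵢ contain both.  Inside a set T of size p + 2 with p even, the p-sets
-- T - a - b, T - a - c (c ∈ T - a) and T - b - c (c ∈ T - b) together invert exactly the pair
-- {a, b} and T itself, with 2p + 3 ≤ 4p - 4 inversions.  A set X of size less than p is the sum
-- of its fewer than C(p,2) pairs; padding them to an even number with a fixed pair {t, s} and
-- choosing T ⊇ X ∪ {t, s}, the copies of T cancel.  So an optimal (≤ p)-solution becomes a
-- (= p)-solution at most (4p - 4) C(p,2) times longer, up to one inversion of {t, s}; taking t a
-- sink of the resulting acyclic digraph and s a sink of the rest, that inversion is harmless.
-- Inverting every backward pair of a vertex ordering shows inv^{≤p} is finite, and minima exist
-- because acyclicity is decidable.

open import Defs
open import Data.Nat using (ℕ; _+_; _*_; _∸_; _≤_)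
open import Data.Nat.Combinatorics using (_C_)
open import Data.Nat.Divisibility using (_∣_; divides)
open import Data.Product using (Σ; _×_)

open import Data.Bool using (Bool; true; false; if_then_else_; _∧_; _∨_; not; _xor_; T)
import Data.Bool.Properties as BoolP
open import Data.Bool.Solver using (module xor-∧-Solver)
open import Data.Empty using (⊥-elim)
open import Data.Fin using (Fin; toℕ) renaming (zero to fzero; suc to fsuc)
import Data.Fin.Properties as FinP
open import Data.Fin.Properties using (_≟_)
open import Data.Fin.Subset using (Subset; ∣_∣; ⊤; ⊥; ⁅_⁆; _∪_; _-_)
import Data.Fin.Subset.Properties as SubsetP
open import Data.List using (List; []; _∷_; length; _++_; map; concatMap)
import Data.List.Properties as ListP
open import Data.List.Relation.Unary.All as All using (All; []; _∷_)
import Data.List.Relation.Unary.All.Properties as AllP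
open import Data.Nat as ℕ using (zero; suc; _<_; z≤n; s≤s)
import Data.Nat.Combinatorics as Comb
import Data.Nat.Properties as ℕP
open import Data.Nat.Tactic.RingSolver using (solve-∀)
open import Data.Product using (_,_; proj₁; proj₂; ∃)
import Data.Product as Product
open import Data.Sum using (_⊎_; inj₁; inj₂)
open import Data.Vec using ([]; _∷_; lookup; tabulate)
import Data.Vec.Properties as VecP
open import Function using (_∘_)
open import Function.Definitions using (Injective)
open import Relation.Binary.Definitions using (tri<; tri≈; tri>)
open import Relation.Binary.PropositionalEquality
open import Relation.Nullary using (¬_; Dec; yes; no; does; ¬?)
open import Relation.Nullary.Decidable as Dec
  using (_×-dec_; _→-dec_; dec-true; dec-false; decidable-stable)

private
  variable
    n : ℕ

-- Parity of inversion sequences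

bothIn : Subset n → Fin n → Fin n → Bool
bothIn X u v = lookup X u ∧ lookup X v

bothIn-comm : (X : Subset n) (u v : Fin n) → bothIn X u v ≡ bothIn X v u
bothIn-comm X u v = BoolP.∧-comm (lookup X u) (lookup X v)

parity : List (Subset n) → Fin n → Fin n → Bool
parity []       u v = false
parity (X ∷ Xs) u v = bothIn X u v xor parity Xs u v

parity-++ : (Xs Ys : List (Subset n)) (u v : Fin n) →
            parity (Xs ++ Ys) u v ≡ parity Xs u v xor parity Ys u v
parity-++ []       Ys u v = refl
parity-++ (X ∷ Xs) Ys u v =
  trans (cong (bothIn X u v xor_) (parity-++ Xs Ys u v))
        (sym (BoolP.xor-assoc (bothIn X u v) (parity Xs u v) (parity Ys u v)))

if-xor : {A : Set} (b c : Bool) (x y : A) →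
         (if c then (if b then x else y) else (if b then y else x)) ≡ (if b xor c then y else x)
if-xor true  true  x y = refl
if-xor true  false x y = refl
if-xor false true  x y = refl
if-xor false false x y = refl

invertAll-parity : (Xs : List (Subset n)) (D : Digraph n) (u v : Fin n) →
                   invertAll Xs D u v ≡ (if parity Xs u v then D v u else D u v)
invertAll-parity []       D u v = refl
invertAll-parity (X ∷ Xs) D u v = begin
  invertAll Xs (invert X D) u v
    ≡⟨ invertAll-parity Xs (invert X D) u v ⟩
  (if c then invert X D v u else invert X D u v)
    ≡⟨ cong (λ b′ → if c then (if b′ then D u v else D v u) else invert X D u v) (bothIn-comm X v u) ⟩
  (if c then (if b then D u v else D v u) else (if b then D v u else D u v))
    ≡⟨ if-xor b c (D u v) (D v u) ⟩
  (if b xor c then D v u else D u v) ∎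
  where
  open ≡-Reasoning
  b = bothIn X u v
  c = parity Xs u v

invertAll-++ : (Xs Ys : List (Subset n)) (D : Digraph n) →
               invertAll (Xs ++ Ys) D ≡ invertAll Ys (invertAll Xs D)
invertAll-++ []       Ys D = refl
invertAll-++ (X ∷ Xs) Ys D = invertAll-++ Xs Ys (invert X D)

if-same : {A : Set} (b : Bool) (x : A) → (if b then x else x) ≡ x
if-same true  x = refl
if-same false x = refl

SameParity : List (Subset n) → List (Subset n) → Set
SameParity {n} Xs Ys = ∀ {u v : Fin n} → u ≢ v → parity Xs u v ≡ parity Ys u v

invertAll-diag : (Xs : List (Subset n)) (D : Digraph n) (u : Fin n) → invertAll Xs D u u ≡ D u u
invertAll-diag Xs D u = trans (invertAll-parity Xs D u u) (if-same (parity Xs u u) (D u u))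

invertAll-sameParity : {Xs Ys : List (Subset n)} → SameParity Xs Ys →
                       (D : Digraph n) (u v : Fin n) → invertAll Xs D u v ≡ invertAll Ys D u v
invertAll-sameParity {Xs = Xs} {Ys} same D u v with u ≟ v
... | yes refl = trans (invertAll-diag Xs D u) (sym (invertAll-diag Ys D u))
... | no u≢v = begin
  invertAll Xs D u v                          ≡⟨ invertAll-parity Xs D u v ⟩
  (if parity Xs u v then D v u else D u v)    ≡⟨ cong (λ b → if b then D v u else D u v) (same u≢v) ⟩
  (if parity Ys u v then D v u else D u v)    ≡⟨ invertAll-parity Ys D u v ⟨
  invertAll Ys D u v                          ∎
  where open ≡-Reasoning

subgraph-acyclic : {D E : Digraph n} → (∀ u v → E u v ≡ true → D u v ≡ true) → Acyclic D → Acyclic E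
subgraph-acyclic E⊆D acyclicD c = acyclicD (record
  { len = len ; vert = vert ; inj = inj ; arcs = λ i → E⊆D _ _ (arcs i) })
  where open DirectedCycle c

acyclic-sameParity : {Xs Ys : List (Subset n)} → SameParity Xs Ys → (D : Digraph n) →
                     Acyclic (invertAll Xs D) → Acyclic (invertAll Ys D)
acyclic-sameParity {Xs = Xs} {Ys} same D =
  subgraph-acyclic (λ u v → trans (invertAll-sameParity {Xs = Xs} {Ys} same D u v))

-- Sinks and decidability of acyclicity

leastSuch : {Q : ℕ → Set} → (∀ k → Dec (Q k)) → ∀ k → Q k →
            Σ ℕ λ m → Q m × (∀ j → Q j → m ≤ j)
leastSuch Q? k q with Q? 0
... | yes q₀ = 0 , q₀ , λ _ _ → z≤n
leastSuch Q? zero    q | no ¬q₀ = ⊥-elim (¬q₀ q)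
leastSuch Q? (suc k) q | no ¬q₀ with leastSuch (Q? ∘ suc) k q
... | m , qm , least = suc m , qm , λ { zero q₀ → ⊥-elim (¬q₀ q₀) ; (suc j) qj → s≤s (least j qj) }

toℕ-next : {len : ℕ} (i : Fin (suc len)) →
           (toℕ i ≡ len × next i ≡ fzero) ⊎ toℕ (next i) ≡ suc (toℕ i)
toℕ-next {zero}  fzero = inj₁ (refl , refl)
toℕ-next {suc k} fzero = inj₂ refl
toℕ-next {suc k} (fsuc i) with next {k} i | toℕ-next {k} i
... | fzero  | inj₁ (i≡k , _) = inj₁ (cong suc i≡k , refl)
... | fsuc j | inj₂ e         = inj₂ (cong suc e)

module Orbit (D : Digraph n) (P : Fin n → Set) (f : Fin n → Fin n)
             (f-pres : ∀ {x} → P x → P (f x)) (f-arc : ∀ {x} → P x → D x (f x) ≡ true) where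

  iter : ℕ → Fin n → Fin n
  iter zero    x = x
  iter (suc k) x = f (iter k x)

  iter-+ : ∀ a b x → iter (a + b) x ≡ iter a (iter b x)
  iter-+ zero    b x = refl
  iter-+ (suc a) b x = cong f (iter-+ a b x)

  iter-pres : ∀ k {x} → P x → P (iter k x)
  iter-pres zero    px = px
  iter-pres (suc k) px = f-pres (iter-pres k px)

  module _ {y : Fin n} (py : P y) (len : ℕ) (period : iter (suc len) y ≡ y)
           (least : ∀ k → 0 < k → iter k y ≡ y → suc len ≤ k) where

    vert : Fin (suc len) → Fin n
    vert i = iter (toℕ i) y

    arcs : (i : Fin (suc len)) → D (vert i) (vert (next i)) ≡ true
    arcs i with toℕ-next i
    ... | inj₁ (i≡len , next≡0) rewrite next≡0 =
      subst (λ z → D (vert i) z ≡ true) (trans (cong (λ m → f (iter m y)) i≡len) period)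
            (f-arc (iter-pres (toℕ i) py))
    ... | inj₂ e = subst (λ m → D (vert i) (iter m y) ≡ true) (sym e) (f-arc (iter-pres (toℕ i) py))

    -- iter a y ≡ iter b y would give the shorter period (suc len ∸ b) + a.
    no-repeat : ∀ a b → a < b → b < suc len → iter a y ≢ iter b y
    no-repeat a b a<b b<k e = ℕP.<-irrefl refl (ℕP.≤-<-trans (least c 0<c returns) c<k)
      where
      k = suc len
      c = (k ∸ b) + a
      0<c : 0 < c
      0<c = ℕP.≤-trans (ℕP.m<n⇒0<n∸m b<k) (ℕP.m≤m+n (k ∸ b) a)
      c<k : c < k
      c<k = subst (c <_) (ℕP.m∸n+n≡m (ℕP.<⇒≤ b<k)) (ℕP.+-monoʳ-< (k ∸ b) a<b)
      returns : iter c y ≡ y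
      returns = begin
        iter ((k ∸ b) + a) y     ≡⟨ iter-+ (k ∸ b) a y ⟩
        iter (k ∸ b) (iter a y)  ≡⟨ cong (iter (k ∸ b)) e ⟩
        iter (k ∸ b) (iter b y)  ≡⟨ iter-+ (k ∸ b) b y ⟨
        iter ((k ∸ b) + b) y     ≡⟨ cong (λ m → iter m y) (ℕP.m∸n+n≡m (ℕP.<⇒≤ b<k)) ⟩
        iter k y                 ≡⟨ period ⟩
        y                        ∎
        where open ≡-Reasoning

    vert-injective : Injective _≡_ _≡_ vert
    vert-injective {i} {j} e with ℕP.<-cmp (toℕ i) (toℕ j)
    ... | tri< i<j _ _ = ⊥-elim (no-repeat (toℕ i) (toℕ j) i<j (FinP.toℕ<n j) e)
    ... | tri≈ _ i≡j _ = FinP.toℕ-injective i≡j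
    ... | tri> _ _ j<i = ⊥-elim (no-repeat (toℕ j) (toℕ i) j<i (FinP.toℕ<n i) (sym e))

    periodicCycle : DirectedCycle D
    periodicCycle = record { len = len ; vert = vert ; inj = vert-injective ; arcs = arcs }

  cycleFrom : ∀ {x} → P x → DirectedCycle D
  cycleFrom {x} px with FinP.pigeonhole (ℕP.n<1+n n) (λ (i : Fin (suc n)) → iter (toℕ i) x)
  ... | i , j , i<j , e
    with leastSuch (λ k → (0 ℕ.<? k) ×-dec (iter k y FinP.≟ y)) (toℕ j ∸ toℕ i) (ℕP.m<n⇒0<n∸m i<j , returns)
    where
    y = iter (toℕ i) x
    returns : iter (toℕ j ∸ toℕ i) y ≡ y
    returns = trans (sym (iter-+ (toℕ j ∸ toℕ i) (toℕ i) x))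
                    (trans (cong (λ m → iter m x) (ℕP.m∸n+n≡m (ℕP.<⇒≤ i<j))) (sym e))
  ... | suc len , (_ , period) , least =
    periodicCycle (iter-pres (toℕ i) px) len period (λ k 0<k e′ → least k (0<k , e′))

IsSinkIn : Digraph n → Subset n → Fin n → Set
IsSinkIn {n} D A t = lookup A t ≡ true × (∀ v → lookup A v ≡ true → D t v ≡ false)

isSinkIn? : (D : Digraph n) (A : Subset n) (t : Fin n) → Dec (IsSinkIn D A t)
isSinkIn? D A t = (lookup A t BoolP.≟ true) ×-dec
                  FinP.all? (λ v → (lookup A v BoolP.≟ true) →-dec (D t v BoolP.≟ false))

acyclic⇒sink : {D : Digraph n} → Acyclic D → (A : Subset n) {a : Fin n} → lookup A a ≡ true →
               ∃ (IsSinkIn D A)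
acyclic⇒sink {n} {D} acyclic A {a} a∈A with FinP.any? (isSinkIn? D A)
... | yes sink  = sink
... | no noSink = ⊥-elim (acyclic (Orbit.cycleFrom D (λ x → lookup A x ≡ true) succ
                                     (λ {x} _ → proj₁ (proj₂ (step x))) (λ {x} → proj₂ (proj₂ (step x))) a∈A))
  where
  step : (x : Fin n) → Σ (Fin n) λ v → lookup A v ≡ true × (lookup A x ≡ true → D x v ≡ true)
  step x with FinP.any? (λ v → (lookup A v BoolP.≟ true) ×-dec (D x v BoolP.≟ true))
  ... | yes (v , v∈A , arc) = v , v∈A , λ _ → arc
  ... | no noOut = a , a∈A , λ x∈A →
    ⊥-elim (noSink (x , x∈A , λ v v∈A → BoolP.¬-not (λ arc → noOut (v , v∈A , arc))))
  succ : Fin n → Fin n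
  succ x = proj₁ (step x)

module _ {D : Digraph n} (c : DirectedCycle D) where
  open DirectedCycle c

  vertexSet : Subset n
  vertexSet = tabulate (λ w → does (FinP.any? (λ i → vert i ≟ w)))

  vert∈vertexSet : ∀ i → lookup vertexSet (vert i) ≡ true
  vert∈vertexSet i = trans (VecP.lookup∘tabulate _ (vert i)) (dec-true (FinP.any? (λ j → vert j ≟ vert i)) (i , refl))

  vertexSet⊆vert : ∀ {w} → lookup vertexSet w ≡ true → ∃ λ i → vert i ≡ w
  vertexSet⊆vert {w} w∈C =
    witness (FinP.any? (λ i → vert i ≟ w)) (trans (sym (VecP.lookup∘tabulate _ w)) w∈C)
    where
    witness : {A : Set} (a? : Dec A) → does a? ≡ true → A
    witness (yes a) _ = a

  cycle-noSink : ¬ ∃ (IsSinkIn D vertexSet)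
  cycle-noSink (t , t∈C , sink) with vertexSet⊆vert t∈C
  ... | i , refl = BoolP.not-¬ (arcs i) (sink (vert (next i)) (vert∈vertexSet (next i)))

SinkIfNonempty : Digraph n → Subset n → Set
SinkIfNonempty D A = (∃ λ a → lookup A a ≡ true) → ∃ (IsSinkIn D A)

sinkIfNonempty? : (D : Digraph n) (A : Subset n) → Dec (SinkIfNonempty D A)
sinkIfNonempty? D A = FinP.any? (λ a → lookup A a BoolP.≟ true) →-dec FinP.any? (isSinkIn? D A)

HasSinks : Digraph n → Set
HasSinks {n} D = (A : Subset n) → SinkIfNonempty D A

hasSinks? : (D : Digraph n) → Dec (HasSinks D)
hasSinks? D with SubsetP.anySubset? (λ A → ¬? (sinkIfNonempty? D A))
... | yes (A , ¬sink) = no (λ hasSinks → ¬sink (hasSinks A))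
... | no  ¬noSink     = yes (λ A → decidable-stable (sinkIfNonempty? D A) (λ ¬sink → ¬noSink (A , ¬sink)))

acyclic⇒hasSinks : {D : Digraph n} → Acyclic D → HasSinks D
acyclic⇒hasSinks acyclic A (_ , a∈A) = acyclic⇒sink acyclic A a∈A

hasSinks⇒acyclic : {D : Digraph n} → HasSinks D → Acyclic D
hasSinks⇒acyclic hasSinks c =
  cycle-noSink c (hasSinks (vertexSet c) (_ , vert∈vertexSet c fzero))

acyclic? : (D : Digraph n) → Dec (Acyclic D)
acyclic? D = Dec.map′ hasSinks⇒acyclic acyclic⇒hasSinks (hasSinks? D)

solvableWith? : {P : Subset n → Set} → (∀ X → Dec (P X)) → (D : Digraph n) (k : ℕ) →
                Dec (SolvableWith P D k)
solvableWith? P? D zero with acyclic? D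
... | yes acyclic = yes ([] , refl , [] , acyclic)
... | no cyclic   = no λ { ([] , _ , _ , acyclic) → cyclic acyclic }
solvableWith? P? D (suc k)
  with SubsetP.anySubset? (λ X → P? X ×-dec solvableWith? P? (invert X D) k)
... | yes (X , pX , Xs , len , all , acyclic) = yes (X ∷ Xs , cong suc len , pX ∷ all , acyclic)
... | no none = no λ { (X ∷ Xs , len , pX ∷ all , acyclic) →
                        none (X , pX , Xs , ℕP.suc-injective len , all , acyclic) }

solvableWith-mono : {P Q : Subset n → Set} → (∀ {X} → P X → Q X) → {D : Digraph n} {k : ℕ} →
                    SolvableWith P D k → SolvableWith Q D k
solvableWith-mono P⇒Q (Xs , len , all , acyclic) = Xs , len , All.map P⇒Q all , acyclic

minInv-exists : {P : Subset n → Set} → (∀ X → Dec (P X)) → {D : Digraph n} {k : ℕ} →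
                SolvableWith P D k → ∃ (IsMinInv P D)
minInv-exists P? {D} {k} = leastSuch (solvableWith? P? D) k

-- Subsets and sums modulo 2

δ : Fin n → Fin n → Bool
δ u a = does (u ≟ a)

lookup-⊥ : (u : Fin n) → lookup (⊥ {n}) u ≡ false
lookup-⊥ u = VecP.lookup-replicate u false

lookup-⊤ : (u : Fin n) → lookup (⊤ {n}) u ≡ true
lookup-⊤ u = VecP.lookup-replicate u true

lookup-⁅⁆ : (a u : Fin n) → lookup ⁅ a ⁆ u ≡ δ u a
lookup-⁅⁆ fzero    fzero    = refl
lookup-⁅⁆ fzero    (fsuc u) = lookup-⊥ u
lookup-⁅⁆ (fsuc a) fzero    = refl
lookup-⁅⁆ (fsuc a) (fsuc u) = lookup-⁅⁆ a u

lookup-∪ : (X Y : Subset n) (u : Fin n) → lookup (X ∪ Y) u ≡ lookup X u ∨ lookup Y u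
lookup-∪ X Y u = VecP.lookup-zipWith _∨_ u X Y

lookup-remove : (X : Subset n) (a u : Fin n) → lookup (X - a) u ≡ lookup X u ∧ not (δ u a)
lookup-remove (x ∷ X) fzero    fzero    = sym (BoolP.∧-zeroʳ x)
lookup-remove (x ∷ X) fzero    (fsuc u) =
  trans (cong (λ Y → lookup Y u) (SubsetP.p─⊥≡p X)) (sym (BoolP.∧-identityʳ (lookup X u)))
lookup-remove (x ∷ X) (fsuc a) fzero    = sym (BoolP.∧-identityʳ x)
lookup-remove (x ∷ X) (fsuc a) (fsuc u) = lookup-remove X a u

lookup-remove-member : (X : Subset n) {a : Fin n} → lookup X a ≡ true →
            (u : Fin n) → lookup (X - a) u ≡ lookup X u xor δ u a
lookup-remove-member X {a} a∈X u with u ≟ a | lookup-remove X a u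
... | yes refl | e rewrite a∈X = e
... | no _     | e = trans e (trans (BoolP.∧-identityʳ _) (sym (BoolP.xor-identityʳ _)))

suc∣X-a∣≡∣X∣ : (X : Subset n) {a : Fin n} → lookup X a ≡ true → suc ∣ X - a ∣ ≡ ∣ X ∣
suc∣X-a∣≡∣X∣ (true ∷ X)  {fzero}  _   = cong (suc ∘ ∣_∣) (SubsetP.p─⊥≡p X)
suc∣X-a∣≡∣X∣ (true ∷ X)  {fsuc a} a∈X = cong suc (suc∣X-a∣≡∣X∣ X a∈X)
suc∣X-a∣≡∣X∣ (false ∷ X) {fsuc a} a∈X = suc∣X-a∣≡∣X∣ X a∈X

∣p∪q∣≤∣p∣+∣q∣ : (p q : Subset n) → ∣ p ∪ q ∣ ≤ ∣ p ∣ + ∣ q ∣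
∣p∪q∣≤∣p∣+∣q∣ []          []      = z≤n
∣p∪q∣≤∣p∣+∣q∣ (true ∷ p)  (y ∷ q) =
  s≤s (ℕP.≤-trans (∣p∪q∣≤∣p∣+∣q∣ p q) (ℕP.+-monoʳ-≤ ∣ p ∣ (SubsetP.∣p∣≤∣x∷p∣ y q)))
∣p∪q∣≤∣p∣+∣q∣ (false ∷ p) (true ∷ q) =
  ℕP.≤-trans (s≤s (∣p∪q∣≤∣p∣+∣q∣ p q)) (ℕP.≤-reflexive (sym (ℕP.+-suc ∣ p ∣ ∣ q ∣)))
∣p∪q∣≤∣p∣+∣q∣ (false ∷ p) (false ∷ q) = ∣p∪q∣≤∣p∣+∣q∣ p q

pair : Fin n → Fin n → Subset n
pair a b = ⁅ a ⁆ ∪ ⁅ b ⁆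

∣pair∣≤2 : (a b : Fin n) → ∣ pair a b ∣ ≤ 2
∣pair∣≤2 a b = ℕP.≤-trans (∣p∪q∣≤∣p∣+∣q∣ ⁅ a ⁆ ⁅ b ⁆)
                          (ℕP.≤-reflexive (cong₂ _+_ (SubsetP.∣⁅x⁆∣≡1 a) (SubsetP.∣⁅x⁆∣≡1 b)))

lookup-pair : {a b : Fin n} → a ≢ b → (u : Fin n) →
              lookup (pair a b) u ≡ δ u a xor δ u b
lookup-pair {a = a} {b} a≢b u
  rewrite lookup-∪ ⁅ a ⁆ ⁅ b ⁆ u | lookup-⁅⁆ a u | lookup-⁅⁆ b u with u ≟ a | u ≟ b
... | yes refl | yes refl = ⊥-elim (a≢b refl)
... | yes _    | no _     = refl
... | no _     | yes _    = refl
... | no _     | no _     = refl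

members : Subset n → List (Fin n)
members []          = []
members (true ∷ X)  = fzero ∷ map fsuc (members X)
members (false ∷ X) = map fsuc (members X)

length-members : (X : Subset n) → length (members X) ≡ ∣ X ∣
length-members []          = refl
length-members (true ∷ X)  = cong suc (trans (ListP.length-map fsuc (members X)) (length-members X))
length-members (false ∷ X) = trans (ListP.length-map fsuc (members X)) (length-members X)

members-∈ : (X : Subset n) → All (λ a → lookup X a ≡ true) (members X)
members-∈ []          = []
members-∈ (true ∷ X)  = refl ∷ AllP.map⁺ (members-∈ X)
members-∈ (false ∷ X) = AllP.map⁺ (members-∈ X)

superset-of-size : (U : Subset n) (k : ℕ) → ∣ U ∣ ≤ k → k ≤ n →
                   Σ (Subset n) λ T → (∀ w → lookup U w ≡ true → lookup T w ≡ true) × ∣ T ∣ ≡ k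
superset-of-size [] zero _ _ = [] , (λ ()) , refl
superset-of-size (true ∷ U) (suc k) (s≤s u≤k) (s≤s k≤n) with superset-of-size U k u≤k k≤n
... | T , U⊆T , ∣T∣ = true ∷ T , (λ { fzero _ → refl ; (fsuc w) w∈U → U⊆T w w∈U }) , cong suc ∣T∣
superset-of-size (false ∷ U) k u≤k k≤n with ∣ U ∣ ℕ.<? k
superset-of-size (false ∷ U) (suc k) _ (s≤s k≤n) | yes (s≤s u≤k) with superset-of-size U k u≤k k≤n
... | T , U⊆T , ∣T∣ = true ∷ T , (λ { (fsuc w) w∈U → U⊆T w w∈U }) , cong suc ∣T∣
superset-of-size (false ∷ U) k u≤k _ | no u≮k =
  false ∷ U , (λ _ w∈U → w∈U) , ℕP.≤-antisym u≤k (ℕP.≮⇒≥ u≮k)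

odd : ℕ → Bool
odd zero    = false
odd (suc n) = not (odd n)

odd-*2 : (q : ℕ) → odd (q * 2) ≡ false
odd-*2 zero    = refl
odd-*2 (suc q) = trans (BoolP.not-involutive (odd (q * 2))) (odd-*2 q)

xorSum : {A : Set} → (A → Bool) → List A → Bool
xorSum f []       = false
xorSum f (x ∷ xs) = f x xor xorSum f xs

module _ {A : Set} where

  xorSum-++ : (f : A → Bool) (xs ys : List A) → xorSum f (xs ++ ys) ≡ xorSum f xs xor xorSum f ys
  xorSum-++ f []       ys = refl
  xorSum-++ f (x ∷ xs) ys =
    trans (cong (f x xor_) (xorSum-++ f xs ys)) (sym (BoolP.xor-assoc (f x) _ _))

  xorSum-map : {B : Set} (f : B → Bool) (g : A → B) (xs : List A) →
               xorSum f (map g xs) ≡ xorSum (f ∘ g) xs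
  xorSum-map f g []       = refl
  xorSum-map f g (x ∷ xs) = cong (f (g x) xor_) (xorSum-map f g xs)

  xorSum-congᴬ : {P : A → Set} {f g : A → Bool} {xs : List A} → All P xs →
                 (∀ {x} → P x → f x ≡ g x) → xorSum f xs ≡ xorSum g xs
  xorSum-congᴬ []         f≗g = refl
  xorSum-congᴬ (px ∷ pxs) f≗g = cong₂ _xor_ (f≗g px) (xorSum-congᴬ pxs f≗g)

  xorSum-cong : {f g : A → Bool} (xs : List A) → (∀ x → f x ≡ g x) → xorSum f xs ≡ xorSum g xs
  xorSum-cong []       f≗g = refl
  xorSum-cong (x ∷ xs) f≗g = cong₂ _xor_ (f≗g x) (xorSum-cong xs f≗g)

  xorSum-xor : (f g : A → Bool) (xs : List A) →
               xorSum (λ x → f x xor g x) xs ≡ xorSum f xs xor xorSum g xs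
  xorSum-xor f g []       = refl
  xorSum-xor f g (x ∷ xs) rewrite xorSum-xor f g xs =
    solve 4 (λ a b c d → (a :+ b) :+ (c :+ d) := (a :+ c) :+ (b :+ d)) refl (f x) (g x) (xorSum f xs) (xorSum g xs)
    where open xor-∧-Solver

  xorSum-const : (c : Bool) (xs : List A) → xorSum (λ _ → c) xs ≡ c ∧ odd (length xs)
  xorSum-const c []       = sym (BoolP.∧-zeroʳ c)
  xorSum-const c (x ∷ xs) rewrite xorSum-const c xs =
    solve 2 (λ c o → c :+ (c :* o) := c :* (con true :+ o)) refl c (odd (length xs))
    where open xor-∧-Solver

-- Pair inversions as inversions of larger sets

parity-map : {A : Set} (h : A → Subset n) (xs : List A) (u v : Fin n) →
             parity (map h xs) u v ≡ xorSum (λ x → bothIn (h x) u v) xs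
parity-map h []       u v = refl
parity-map h (x ∷ xs) u v = cong (bothIn (h x) u v xor_) (parity-map h xs u v)

parity-concatMap : {A : Set} (h : A → List (Subset n)) (xs : List A) (u v : Fin n) →
                   parity (concatMap h xs) u v ≡ xorSum (λ x → parity (h x) u v) xs
parity-concatMap h []       u v = refl
parity-concatMap h (x ∷ xs) u v =
  trans (parity-++ (h x) (concatMap h xs) u v) (cong (parity (h x) u v xor_) (parity-concatMap h xs u v))

xorSum-members-δ : (g : Fin n → Bool) (X : Subset n) (v : Fin n) →
                   xorSum (λ j → δ v j ∧ g j) (members X) ≡ lookup X v ∧ g v
xorSum-members-δ g (true ∷ X) fzero =
  trans (cong (g fzero xor_) (trans (xorSum-map _ fsuc (members X)) (xorSum-const false (members X))))
        (BoolP.xor-identityʳ (g fzero))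
xorSum-members-δ g (false ∷ X) fzero =
  trans (xorSum-map _ fsuc (members X)) (xorSum-const false (members X))
xorSum-members-δ g (true ∷ X) (fsuc v) =
  trans (xorSum-map _ fsuc (members X)) (xorSum-members-δ (g ∘ fsuc) X v)
xorSum-members-δ g (false ∷ X) (fsuc v) =
  trans (xorSum-map _ fsuc (members X)) (xorSum-members-δ (g ∘ fsuc) X v)

δ-both : {u v : Fin n} → u ≢ v → (c : Fin n) → δ u c ∧ δ v c ≡ false
δ-both {u = u} {v} u≢v c with u ≟ c | v ≟ c
... | yes refl | yes refl = ⊥-elim (u≢v refl)
... | yes _    | no _     = refl
... | no _     | _        = refl

odd∣X-a∣ : (X : Subset n) {a : Fin n} → lookup X a ≡ true → odd ∣ X - a ∣ ≡ not (odd ∣ X ∣)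
odd∣X-a∣ X a∈X = trans (sym (BoolP.not-involutive _)) (cong (not ∘ odd) (suc∣X-a∣≡∣X∣ X a∈X))

removals : Subset n → List (Subset n)
removals Z = map (Z -_) (members Z)

length-removals : (Z : Subset n) → length (removals Z) ≡ ∣ Z ∣
length-removals Z = trans (ListP.length-map (Z -_) (members Z)) (length-members Z)

removals-size : (Z : Subset n) → All (λ Y → suc ∣ Y ∣ ≡ ∣ Z ∣) (removals Z)
removals-size Z = AllP.map⁺ (All.map (suc∣X-a∣≡∣X∣ Z) (members-∈ Z))

-- Each pair u ≢ v of Z lies in exactly ∣ Z ∣ ∸ 2 of the sets Z - c.
parity-removals : (Z : Subset n) {u v : Fin n} → u ≢ v →
                  parity (removals Z) u v ≡ bothIn Z u v ∧ odd ∣ Z ∣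
parity-removals Z {u} {v} u≢v = begin
  parity (removals Z) u v
    ≡⟨ parity-map (Z -_) (members Z) u v ⟩
  xorSum (λ c → bothIn (Z - c) u v) (members Z)
    ≡⟨ xorSum-congᴬ (members-∈ Z) (λ c∈Z →
         cong₂ _∧_ (lookup-remove-member Z c∈Z u) (lookup-remove-member Z c∈Z v)) ⟩
  xorSum (λ c → (zu xor δ u c) ∧ (zv xor δ v c)) (members Z)
    ≡⟨ xorSum-cong (members Z) expand ⟩
  xorSum (λ c → zu ∧ zv xor (δ u c ∧ zv xor δ v c ∧ zu)) (members Z)
    ≡⟨ xorSum-xor _ _ (members Z) ⟩
  xorSum (λ _ → zu ∧ zv) (members Z) xor xorSum (λ c → δ u c ∧ zv xor δ v c ∧ zu) (members Z)
    ≡⟨ cong₂ _xor_ (xorSum-const (zu ∧ zv) (members Z)) (xorSum-xor _ _ (members Z)) ⟩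
  (zu ∧ zv) ∧ odd (length (members Z)) xor
    (xorSum (λ c → δ u c ∧ zv) (members Z) xor xorSum (λ c → δ v c ∧ zu) (members Z))
    ≡⟨ cong₂ (λ k s → (zu ∧ zv) ∧ odd k xor s) (length-members Z)
             (cong₂ _xor_ (xorSum-members-δ (λ _ → zv) Z u) (xorSum-members-δ (λ _ → zu) Z v)) ⟩
  (zu ∧ zv) ∧ odd ∣ Z ∣ xor (zu ∧ zv xor zv ∧ zu)
    ≡⟨ solve 3 (λ x y o → (x :* y) :* o :+ (x :* y :+ y :* x) := (x :* y) :* o) refl zu zv (odd ∣ Z ∣) ⟩
  (zu ∧ zv) ∧ odd ∣ Z ∣ ∎
  where
  open ≡-Reasoning
  open xor-∧-Solver
  zu = lookup Z u
  zv = lookup Z v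
  expand : ∀ c → (zu xor δ u c) ∧ (zv xor δ v c) ≡ zu ∧ zv xor (δ u c ∧ zv xor δ v c ∧ zu)
  expand c = trans
    (solve 4 (λ x y a b → (x :+ a) :* (y :+ b) := (x :* y :+ (a :* y :+ b :* x)) :+ a :* b) refl
           zu zv (δ u c) (δ v c))
    (trans (cong (rest xor_) (δ-both u≢v c)) (BoolP.xor-identityʳ rest))
    where rest = zu ∧ zv xor (δ u c ∧ zv xor δ v c ∧ zu)

gadget : Subset n → Fin n → Fin n → List (Subset n)
gadget T a b = (T - a - b) ∷ removals (T - a) ++ removals (T - b)

module _ (T : Subset n) {a b : Fin n} (a≢b : a ≢ b)
         (a∈T : lookup T a ≡ true) (b∈T : lookup T b ≡ true) where

  private
    b∈T-a : lookup (T - a) b ≡ true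
    b∈T-a = trans (lookup-remove-member T a∈T b) (cong₂ _xor_ b∈T (dec-false (b ≟ a) (a≢b ∘ sym)))

    lookup-T-a-b : ∀ u → lookup (T - a - b) u ≡ (lookup T u xor δ u a) xor δ u b
    lookup-T-a-b u = trans (lookup-remove-member (T - a) b∈T-a u) (cong (_xor δ u b) (lookup-remove-member T a∈T u))

    ∣T-c∣ : ∀ {p c} → lookup T c ≡ true → ∣ T ∣ ≡ 2 + p → ∣ T - c ∣ ≡ suc p
    ∣T-c∣ c∈T ∣T∣ = ℕP.suc-injective (trans (suc∣X-a∣≡∣X∣ T c∈T) ∣T∣)

  gadget-size : {p : ℕ} → ∣ T ∣ ≡ 2 + p → All (λ Y → ∣ Y ∣ ≡ p) (gadget T a b)
  gadget-size {p} ∣T∣ =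
    ℕP.suc-injective (trans (suc∣X-a∣≡∣X∣ (T - a) b∈T-a) (∣T-c∣ a∈T ∣T∣))
    ∷ AllP.++⁺ (removed a∈T) (removed b∈T)
    where
    removed : ∀ {c} → lookup T c ≡ true → All (λ Y → ∣ Y ∣ ≡ p) (removals (T - c))
    removed c∈T = All.map (λ e → ℕP.suc-injective (trans e (∣T-c∣ c∈T ∣T∣))) (removals-size (T - _))

  length-gadget : {p : ℕ} → ∣ T ∣ ≡ 2 + p → length (gadget T a b) ≡ suc (suc p + suc p)
  length-gadget ∣T∣ = cong suc (trans (ListP.length-++ (removals (T - a)))
    (cong₂ _+_ (trans (length-removals (T - a)) (∣T-c∣ a∈T ∣T∣))
               (trans (length-removals (T - b)) (∣T-c∣ b∈T ∣T∣))))

  -- The removals of the odd sets T - a and T - b act as inversions of T - a and T - b, and off the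
  -- diagonal K(T-a-b) + K(T-a) + K(T-b) = K(T) + K({a,b}) for the pair indicators K = bothIn _.
  parity-gadget : odd ∣ T ∣ ≡ false → {u v : Fin n} → u ≢ v →
                  parity (gadget T a b) u v ≡ bothIn T u v xor bothIn (pair a b) u v
  parity-gadget even {u} {v} u≢v = begin
    parity (gadget T a b) u v
      ≡⟨ cong (bothIn (T - a - b) u v xor_) (parity-++ (removals (T - a)) (removals (T - b)) u v) ⟩
    bothIn (T - a - b) u v xor (parity (removals (T - a)) u v xor parity (removals (T - b)) u v)
      ≡⟨ cong₂ (λ x y → bothIn (T - a - b) u v xor (x xor y)) (removed a∈T) (removed b∈T) ⟩
    bothIn (T - a - b) u v xor (bothIn (T - a) u v xor bothIn (T - b) u v)
      ≡⟨ cong₂ _xor_ (cong₂ _∧_ (lookup-T-a-b u) (lookup-T-a-b v))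
                     (cong₂ _xor_ (cong₂ _∧_ (lookup-remove-member T a∈T u) (lookup-remove-member T a∈T v))
                                  (cong₂ _∧_ (lookup-remove-member T b∈T u) (lookup-remove-member T b∈T v))) ⟩
    ((xu xor δ u a) xor δ u b) ∧ ((xv xor δ v a) xor δ v b) xor
      ((xu xor δ u a) ∧ (xv xor δ v a) xor (xu xor δ u b) ∧ (xv xor δ v b))
      ≡⟨ solve 6 (λ x y αu αv βu βv →
                    ((x :+ αu) :+ βu) :* ((y :+ αv) :+ βv) :+ ((x :+ αu) :* (y :+ αv) :+ (x :+ βu) :* (y :+ βv))
                    := (x :* y :+ (αu :+ βu) :* (αv :+ βv)) :+ (αu :* αv :+ βu :* βv))
               refl xu xv (δ u a) (δ v a) (δ u b) (δ v b) ⟩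
    K xor (δ u a ∧ δ v a xor δ u b ∧ δ v b)
      ≡⟨ cong (K xor_) (cong₂ _xor_ (δ-both u≢v a) (δ-both u≢v b)) ⟩
    K xor false
      ≡⟨ BoolP.xor-identityʳ K ⟩
    xu ∧ xv xor (δ u a xor δ u b) ∧ (δ v a xor δ v b)
      ≡⟨ cong (xu ∧ xv xor_) (cong₂ _∧_ (lookup-pair a≢b u) (lookup-pair a≢b v)) ⟨
    bothIn T u v xor bothIn (pair a b) u v ∎
    where
    open ≡-Reasoning
    open xor-∧-Solver
    xu = lookup T u
    xv = lookup T v
    K = xu ∧ xv xor (δ u a xor δ u b) ∧ (δ v a xor δ v b)
    removed : ∀ {c} → lookup T c ≡ true → parity (removals (T - c)) u v ≡ bothIn (T - c) u v
    removed {c} c∈T = trans (parity-removals (T - c) u≢v)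
      (trans (cong (bothIn (T - c) u v ∧_) (trans (odd∣X-a∣ T c∈T) (cong not even)))
             (BoolP.∧-identityʳ _))

pairs : Subset n → List (Fin n × Fin n)
pairs []          = []
pairs (true ∷ X)  = map (λ j → fzero , fsuc j) (members X) ++ map (Product.map fsuc fsuc) (pairs X)
pairs (false ∷ X) = map (Product.map fsuc fsuc) (pairs X)

length-pairs : (X : Subset n) → length (pairs X) ≡ ∣ X ∣ C 2
length-pairs []          = refl
length-pairs (true ∷ X)  = begin
  length (map (λ j → fzero , fsuc j) (members X) ++ map (Product.map fsuc fsuc) (pairs X))
    ≡⟨ ListP.length-++ (map (λ j → fzero , fsuc j) (members X)) ⟩
  length (map (λ j → fzero , fsuc j) (members X)) + length (map (Product.map fsuc fsuc) (pairs X))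
    ≡⟨ cong₂ _+_ (trans (ListP.length-map _ (members X)) (length-members X))
                 (trans (ListP.length-map _ (pairs X)) (length-pairs X)) ⟩
  ∣ X ∣ + ∣ X ∣ C 2
    ≡⟨ cong (_+ ∣ X ∣ C 2) (Comb.nC1≡n ∣ X ∣) ⟨
  ∣ X ∣ C 1 + ∣ X ∣ C 2
    ≡⟨ Comb.nCk+nC[k+1]≡[n+1]C[k+1] ∣ X ∣ 1 ⟩
  suc ∣ X ∣ C 2 ∎
  where open ≡-Reasoning
length-pairs (false ∷ X) = trans (ListP.length-map _ (pairs X)) (length-pairs X)

PairIn : Subset n → Fin n × Fin n → Set
PairIn X (a , b) = a ≢ b × lookup X a ≡ true × lookup X b ≡ true

pairs-in : (X : Subset n) → All (PairIn X) (pairs X)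
pairs-in []          = []
pairs-in (true ∷ X)  =
  AllP.++⁺ (AllP.map⁺ (All.map (λ j∈X → (λ ()) , refl , j∈X) (members-∈ X))) (shift (pairs-in X))
  where
  shift : ∀ {x} {qs} → All (PairIn X) qs → All (PairIn (x ∷ X)) (map (Product.map fsuc fsuc) qs)
  shift = AllP.map⁺ ∘ All.map (λ (a≢b , a∈X , b∈X) → a≢b ∘ FinP.suc-injective , a∈X , b∈X)
pairs-in (false ∷ X) =
  AllP.map⁺ (All.map (λ (a≢b , a∈X , b∈X) → a≢b ∘ FinP.suc-injective , a∈X , b∈X) (pairs-in X))

increasing : (Fin n → Fin n → Bool) → Fin n → Fin n → Bool
increasing w u v = if toℕ u ℕ.<ᵇ toℕ v then w u v else w v u

lookup-pair-0-suc : (j u : Fin n) → lookup (pair fzero (fsuc j)) (fsuc u) ≡ δ u j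
lookup-pair-0-suc j u = trans (lookup-∪ ⊥ ⁅ j ⁆ u) (cong₂ _∨_ (lookup-⊥ u) (lookup-⁅⁆ j u))

bothIn-pair-suc-0 : (w : Fin (suc n) → Fin (suc n) → Bool) (u : Fin n) ((a , b) : Fin n × Fin n) →
           bothIn (pair (fsuc a) (fsuc b)) (fsuc u) fzero ∧ w (fsuc a) (fsuc b) ≡ false
bothIn-pair-suc-0 w u (a , b) = cong (_∧ w (fsuc a) (fsuc b)) (BoolP.∧-zeroʳ _)

xorSum-pairs-true∷ : (f : Fin (suc n) × Fin (suc n) → Bool) (X : Subset n) →
                     xorSum f (pairs (true ∷ X)) ≡
                     xorSum (λ j → f (fzero , fsuc j)) (members X) xor xorSum (f ∘ Product.map fsuc fsuc) (pairs X)
xorSum-pairs-true∷ f X = trans (xorSum-++ f (map (λ j → fzero , fsuc j) (members X)) _)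
                               (cong₂ _xor_ (xorSum-map f _ (members X)) (xorSum-map f _ (pairs X)))

xorSum-pairs : (w : Fin n → Fin n → Bool) (X : Subset n) {u v : Fin n} → u ≢ v →
               xorSum (λ (a , b) → bothIn (pair a b) u v ∧ w a b) (pairs X) ≡ bothIn X u v ∧ increasing w u v
xorSum-pairs w [] {()}
xorSum-pairs w (_ ∷ X) {fzero} {fzero} u≢v = ⊥-elim (u≢v refl)
xorSum-pairs w (true ∷ X) {fzero} {fsuc v} _ = begin
  xorSum _ (pairs (true ∷ X))
    ≡⟨ xorSum-pairs-true∷ _ X ⟩
  xorSum _ (members X) xor xorSum _ (pairs X)
    ≡⟨ cong₂ _xor_ (xorSum-cong (members X) λ j → cong (_∧ w fzero (fsuc j)) (lookup-pair-0-suc j v))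
                   (xorSum-const false (pairs X)) ⟩
  xorSum (λ j → δ v j ∧ w fzero (fsuc j)) (members X) xor false
    ≡⟨ BoolP.xor-identityʳ _ ⟩
  xorSum (λ j → δ v j ∧ w fzero (fsuc j)) (members X)
    ≡⟨ xorSum-members-δ (λ j → w fzero (fsuc j)) X v ⟩
  lookup X v ∧ w fzero (fsuc v) ∎
  where open ≡-Reasoning
xorSum-pairs w (true ∷ X) {fsuc u} {fzero} _ = begin
  xorSum _ (pairs (true ∷ X))
    ≡⟨ xorSum-pairs-true∷ _ X ⟩
  xorSum _ (members X) xor xorSum _ (pairs X)
    ≡⟨ cong₂ _xor_ (xorSum-cong (members X) λ j →
                     cong (_∧ w fzero (fsuc j)) (trans (BoolP.∧-identityʳ _) (lookup-pair-0-suc j u)))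
                   (trans (xorSum-cong (pairs X) (bothIn-pair-suc-0 w u)) (xorSum-const false (pairs X))) ⟩
  xorSum (λ j → δ u j ∧ w fzero (fsuc j)) (members X) xor false
    ≡⟨ BoolP.xor-identityʳ _ ⟩
  xorSum (λ j → δ u j ∧ w fzero (fsuc j)) (members X)
    ≡⟨ xorSum-members-δ (λ j → w fzero (fsuc j)) X u ⟩
  lookup X u ∧ w fzero (fsuc u)
    ≡⟨ cong (_∧ w fzero (fsuc u)) (BoolP.∧-identityʳ (lookup X u)) ⟨
  (lookup X u ∧ true) ∧ w fzero (fsuc u) ∎
  where open ≡-Reasoning
xorSum-pairs w (false ∷ X) {fzero} {fsuc v} _ =
  trans (xorSum-map _ _ (pairs X)) (xorSum-const false (pairs X))
xorSum-pairs w (false ∷ X) {fsuc u} {fzero} _ = begin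
  xorSum _ (pairs (false ∷ X))
    ≡⟨ xorSum-map _ _ (pairs X) ⟩
  xorSum _ (pairs X)
    ≡⟨ xorSum-cong (pairs X) (bothIn-pair-suc-0 w u) ⟩
  xorSum (λ _ → false) (pairs X)
    ≡⟨ xorSum-const false (pairs X) ⟩
  false
    ≡⟨ cong (_∧ w fzero (fsuc u)) (BoolP.∧-zeroʳ (lookup X u)) ⟨
  (lookup X u ∧ false) ∧ w fzero (fsuc u) ∎
  where open ≡-Reasoning
xorSum-pairs w (true ∷ X) {fsuc u} {fsuc v} u≢v = begin
  xorSum _ (pairs (true ∷ X))
    ≡⟨ xorSum-pairs-true∷ _ X ⟩
  xorSum _ (members X) xor xorSum _ (pairs X)
    ≡⟨ cong (_xor xorSum _ (pairs X)) (trans (xorSum-cong (members X) λ j →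
          cong (_∧ w fzero (fsuc j)) (trans (cong₂ _∧_ (lookup-pair-0-suc j u) (lookup-pair-0-suc j v))
                                            (δ-both (u≢v ∘ cong fsuc) j)))
          (xorSum-const false (members X))) ⟩
  false xor xorSum _ (pairs X)
    ≡⟨ xorSum-pairs (λ a b → w (fsuc a) (fsuc b)) X (u≢v ∘ cong fsuc) ⟩
  bothIn X u v ∧ increasing w (fsuc u) (fsuc v) ∎
  where open ≡-Reasoning
xorSum-pairs w (false ∷ X) {fsuc u} {fsuc v} u≢v =
  trans (xorSum-map _ _ (pairs X)) (xorSum-pairs (λ a b → w (fsuc a) (fsuc b)) X (u≢v ∘ cong fsuc))

-- Acyclicity under pair inversions

∈pairˡ : (a b : Fin n) → lookup (pair a b) a ≡ true
∈pairˡ a b = trans (lookup-∪ ⁅ a ⁆ ⁅ b ⁆ a)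
  (cong (_∨ lookup ⁅ b ⁆ a) (trans (lookup-⁅⁆ a a) (dec-true (a ≟ a) refl)))

∈pairʳ : (a b : Fin n) → lookup (pair a b) b ≡ true
∈pairʳ a b = trans (lookup-∪ ⁅ a ⁆ ⁅ b ⁆ b)
  (trans (cong (lookup ⁅ a ⁆ b ∨_) (trans (lookup-⁅⁆ b b) (dec-true (b ≟ b) refl))) (BoolP.∨-zeroʳ _))

∈pair⁻ : (a b : Fin n) {w : Fin n} → lookup (pair a b) w ≡ true → w ≡ a ⊎ w ≡ b
∈pair⁻ a b {w} w∈ab with w ≟ a | w ≟ b | trans (sym (lookup-∪ ⁅ a ⁆ ⁅ b ⁆ w)) w∈ab
... | yes w≡a | _      | _ = inj₁ w≡a
... | no _    | yes w≡b | _ = inj₂ w≡b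
... | no w≢a  | no w≢b | e rewrite lookup-⁅⁆ a w | lookup-⁅⁆ b w
                             | dec-false (w ≟ a) w≢a | dec-false (w ≟ b) w≢b = ⊥-elim (BoolP.not-¬ refl e)

invert-arc : (X : Subset n) (D : Digraph n) {u v : Fin n} → invert X D u v ≡ true →
             (lookup X u ≡ true × lookup X v ≡ true × D v u ≡ true) ⊎ (bothIn X u v ≡ false × D u v ≡ true)
invert-arc X D {u} {v} arc with lookup X u | lookup X v
... | true  | true  = inj₁ (refl , refl , arc)
... | true  | false = inj₂ (refl , arc)
... | false | _     = inj₂ (refl , arc)

module _ {D : Digraph n} (acyclic : Acyclic D) {t s : Fin n} (t≢s : t ≢ s)
         (t-sink : ∀ v → D t v ≡ false) (s-sink : ∀ v → v ≢ t → D s v ≡ false) where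

  private
    E : Digraph n
    E = invert (pair t s) D

    s-sinkᴱ : ∀ w → E s w ≢ true
    s-sinkᴱ w arc with invert-arc (pair t s) D arc
    ... | inj₁ (_ , w∈ , D-ws) with ∈pair⁻ t s w∈
    ...   | inj₁ refl = BoolP.not-¬ D-ws (t-sink s)
    ...   | inj₂ refl = BoolP.not-¬ D-ws (s-sink s (t≢s ∘ sym))
    s-sinkᴱ w arc | inj₂ (s,w∉ , D-sw) with w ≟ t
    ... | no w≢t    = BoolP.not-¬ D-sw (s-sink w w≢t)
    ... | yes refl  = BoolP.not-¬ s,w∉ (cong₂ _∧_ (∈pairʳ t s) (∈pairˡ t s))

    arcᴱ⇒arc : ∀ {u v} → E u v ≡ true → v ≢ s → D u v ≡ true
    arcᴱ⇒arc arc v≢s with invert-arc (pair t s) D arc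
    ... | inj₂ (_ , D-uv) = D-uv
    ... | inj₁ (_ , v∈ , D-vu) with ∈pair⁻ t s v∈
    ...   | inj₁ refl = ⊥-elim (BoolP.not-¬ D-vu (t-sink _))
    ...   | inj₂ v≡s  = ⊥-elim (v≢s v≡s)

  acyclic-invert-last-pair : Acyclic (invert (pair t s) D)
  acyclic-invert-last-pair c = acyclic (record
    { len = len ; vert = vert ; inj = inj
    ; arcs = λ i → arcᴱ⇒arc (arcs i) λ e →
               s-sinkᴱ _ (subst (λ z → E z (vert (next (next i))) ≡ true) e (arcs (next i))) })
    where open DirectedCycle c

∈⊤-t : {v t : Fin n} → v ≢ t → lookup (⊤ - t) v ≡ true
∈⊤-t {v = v} {t} v≢t =
  trans (lookup-remove ⊤ t v) (cong₂ (λ x y → x ∧ not y) (lookup-⊤ v) (dec-false (v ≟ t) v≢t))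

t∉⊤-t : (t : Fin n) → lookup (⊤ - t) t ≡ false
t∉⊤-t t = trans (lookup-remove ⊤ t t) (cong₂ (λ x y → x ∧ not y) (lookup-⊤ t) (dec-true (t ≟ t) refl))

other-vertex : 2 ≤ n → (t : Fin n) → ∃ λ o → o ≢ t
other-vertex (s≤s (s≤s z≤n)) fzero    = fsuc fzero , λ ()
other-vertex (s≤s (s≤s z≤n)) (fsuc _) = fzero , λ ()

safe-pair : 2 ≤ n → {D : Digraph n} → Acyclic D →
            Σ (Fin n) λ t → Σ (Fin n) λ s → t ≢ s × Acyclic (invert (pair t s) D)
safe-pair {zero} ()
safe-pair {suc m} 2≤n {D} acyclic
  with acyclic⇒sink acyclic ⊤ {fzero} (lookup-⊤ {n = suc m} fzero)
... | t , _ , t-sink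
  with acyclic⇒sink acyclic (⊤ - t) (∈⊤-t (proj₂ (other-vertex 2≤n t)))
... | s , s∈⊤-t , s-sink = t , s , t≢s ,
  acyclic-invert-last-pair acyclic t≢s (λ v → t-sink v (lookup-⊤ v)) (λ v v≢t → s-sink v (∈⊤-t v≢t))
  where
  t≢s : t ≢ s
  t≢s refl = BoolP.not-¬ s∈⊤-t (t∉⊤-t t)

argmax : ∀ m (h : Fin (suc m) → ℕ) → Σ (Fin (suc m)) λ i → ∀ j → h j ≤ h i
argmax zero    h = fzero , λ { fzero → ℕP.≤-refl }
argmax (suc m) h with argmax m (h ∘ fsuc)
... | i , max with h fzero ℕ.≤? h (fsuc i)
...   | yes h₀≤ = fsuc i , λ { fzero → h₀≤ ; (fsuc j) → max j }
...   | no  h₀≰ = fzero , λ { fzero    → ℕP.≤-refl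
                          ; (fsuc j) → ℕP.≤-trans (max j) (ℕP.<⇒≤ (ℕP.≰⇒> h₀≰)) }

increasing⇒acyclic : {E : Digraph n} → (∀ {u v} → E u v ≡ true → toℕ u < toℕ v) → Acyclic E
increasing⇒acyclic increasing c with argmax (DirectedCycle.len c) (toℕ ∘ DirectedCycle.vert c)
... | i , max = ℕP.<-irrefl refl (ℕP.<-≤-trans (increasing (DirectedCycle.arcs c i)) (max (next i)))

parity-if : (c : Bool) (X : Subset n) (u v : Fin n) →
            parity (if c then X ∷ [] else []) u v ≡ bothIn X u v ∧ c
parity-if true  X u v = trans (BoolP.xor-identityʳ _) (sym (BoolP.∧-identityʳ _))
parity-if false X u v = sym (BoolP.∧-zeroʳ _)

module _ {D : Digraph n} (oriented : IsOriented D) where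

  reorient : Fin n × Fin n → List (Subset n)
  reorient (a , b) = if D b a then pair a b ∷ [] else []

  sorting : List (Subset n)
  sorting = concatMap reorient (pairs ⊤)

  sorting-sizes : All (λ X → ∣ X ∣ ≤ 2) sorting
  sorting-sizes = AllP.concat⁺ (AllP.map⁺ {xs = pairs ⊤} (All.tabulate λ {q} _ → sizes q))
    where
    sizes : ∀ q → All (λ X → ∣ X ∣ ≤ 2) (reorient q)
    sizes (a , b) with D b a
    ... | true  = ∣pair∣≤2 a b ∷ []
    ... | false = []

  parity-sorting : {u v : Fin n} → u ≢ v → parity sorting u v ≡ increasing (λ a b → D b a) u v
  parity-sorting {u} {v} u≢v = begin
    parity sorting u v
      ≡⟨ parity-concatMap reorient (pairs ⊤) u v ⟩
    xorSum (λ (a , b) → parity (if D b a then pair a b ∷ [] else []) u v) (pairs ⊤)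
      ≡⟨ xorSum-cong (pairs ⊤) (λ (a , b) → parity-if (D b a) (pair a b) u v) ⟩
    xorSum (λ (a , b) → bothIn (pair a b) u v ∧ D b a) (pairs ⊤)
      ≡⟨ xorSum-pairs (λ a b → D b a) ⊤ u≢v ⟩
    bothIn ⊤ u v ∧ increasing (λ a b → D b a) u v
      ≡⟨ cong (λ b → b ∧ increasing (λ a b → D b a) u v) (cong₂ _∧_ (lookup-⊤ u) (lookup-⊤ v)) ⟩
    increasing (λ a b → D b a) u v ∎
    where open ≡-Reasoning

  sorting-increasing : ∀ {u v} → invertAll sorting D u v ≡ true → toℕ u < toℕ v
  sorting-increasing {u} {v} arc with u ≟ v
  ... | yes refl = ⊥-elim (BoolP.not-¬ (trans (sym (invertAll-diag sorting D u)) arc) (proj₁ oriented u))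
  ... | no u≢v
    with toℕ u ℕ.<ᵇ toℕ v in u<v
       | trans (sym (trans (invertAll-parity sorting D u v)
                           (cong (λ b → if b then D v u else D u v) (parity-sorting u≢v)))) arc
  ...  | true  | _   = ℕP.<ᵇ⇒< (toℕ u) (toℕ v) (subst T (sym u<v) _)
  ...  | false | arc′ with D u v in uv
  ...    | true  = ⊥-elim (BoolP.not-¬ arc′ (proj₂ oriented u v uv))
  ...    | false = ⊥-elim (BoolP.not-¬ arc′ refl)

  sorting-solution : {p : ℕ} → 2 ≤ p → SolvableWith (AtMostP p) D (length sorting)
  sorting-solution 2≤p = sorting , refl , All.map (λ ≤2 → ℕP.≤-trans ≤2 2≤p) sorting-sizes ,
                         increasing⇒acyclic sorting-increasing

-- Replacing (≤ p)-inversions by (= p)-inversions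

suc-C2 : ∀ r → suc r C 2 ≡ r + r C 2
suc-C2 r = trans (sym (Comb.nCk+nC[k+1]≡[n+1]C[k+1] r 1)) (cong (_+ r C 2) (Comb.nC1≡n r))

C2-mono : {m n : ℕ} → m ≤ n → m C 2 ≤ n C 2
C2-mono {m} m≤n = go (ℕP.≤⇒≤′ m≤n)
  where
  go : ∀ {k} → m ℕ.≤′ k → m C 2 ≤ k C 2
  go ℕ.≤′-refl = ℕP.≤-refl
  go (ℕ.≤′-step {k} m≤′k) = ℕP.≤-trans (go m≤′k) (subst (k C 2 ≤_) (sym (suc-C2 k)) (ℕP.m≤n+m _ k))

C2-< : {m n : ℕ} → m < n → 2 ≤ n → suc (m C 2) ≤ n C 2
C2-< {m} {suc r} (s≤s m≤r) (s≤s 1≤r) =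
  subst (suc (m C 2) ≤_) (sym (suc-C2 r)) (ℕP.+-mono-≤ 1≤r (C2-mono m≤r))

gadget-length≤ : {p : ℕ} → 4 ≤ p → suc (suc p + suc p) ≤ 4 * p ∸ 4
gadget-length≤ (s≤s (s≤s (s≤s (s≤s {n = k} z≤n)))) =
  subst (suc (suc ((4 + k) + suc (4 + k))) ≤_) (identity k) (ℕP.m≤m+n _ (suc (k + k)))
  where
  identity : ∀ k → suc (suc ((4 + k) + suc (4 + k))) + suc (k + k) ≡ k + 3 * (4 + k)
  identity = solve-∀

ParityModulo : Subset n → List (Subset n) → List (Subset n) → Set
ParityModulo {n} g Ys Xs =
  Σ Bool λ b → ∀ {u v : Fin n} → u ≢ v → parity Ys u v ≡ parity Xs u v xor (b ∧ bothIn g u v)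

parityModulo-++ : {g : Subset n} {Ys Xs Ys′ Xs′ : List (Subset n)} →
                  ParityModulo g Ys Xs → ParityModulo g Ys′ Xs′ → ParityModulo g (Ys ++ Ys′) (Xs ++ Xs′)
parityModulo-++ {g = g} {Ys} {Xs} {Ys′} {Xs′} (b , eq) (b′ , eq′) = b xor b′ , λ {u} {v} u≢v → begin
  parity (Ys ++ Ys′) u v
    ≡⟨ parity-++ Ys Ys′ u v ⟩
  parity Ys u v xor parity Ys′ u v
    ≡⟨ cong₂ _xor_ (eq u≢v) (eq′ u≢v) ⟩
  (parity Xs u v xor b ∧ bothIn g u v) xor (parity Xs′ u v xor b′ ∧ bothIn g u v)
    ≡⟨ solve 5 (λ x b x′ b′ k → (x :+ b :* k) :+ (x′ :+ b′ :* k) := (x :+ x′) :+ (b :+ b′) :* k)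
             refl (parity Xs u v) b (parity Xs′ u v) b′ (bothIn g u v) ⟩
  (parity Xs u v xor parity Xs′ u v) xor (b xor b′) ∧ bothIn g u v
    ≡⟨ cong (_xor (b xor b′) ∧ bothIn g u v) (parity-++ Xs Xs′ u v) ⟨
  parity (Xs ++ Xs′) u v xor (b xor b′) ∧ bothIn g u v ∎
  where
  open ≡-Reasoning
  open xor-∧-Solver

acyclic-parityModulo : {g : Subset n} {Ys Xs : List (Subset n)} (D : Digraph n) → ParityModulo g Ys Xs →
                       Acyclic (invertAll Xs D) → Acyclic (invert g (invertAll Xs D)) → Acyclic (invertAll Ys D)
acyclic-parityModulo {Ys = Ys} {Xs} D (false , eq) acyclic _ =
  acyclic-sameParity {Xs = Xs} {Ys} (λ u≢v → sym (trans (eq u≢v) (BoolP.xor-identityʳ _))) D acyclic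
acyclic-parityModulo {g = g} {Ys} {Xs} D (true , eq) _ acyclic =
  acyclic-sameParity {Xs = Xs ++ g ∷ []} {Ys} same D (subst Acyclic (sym (invertAll-++ Xs (g ∷ []) D)) acyclic)
  where
  same : SameParity (Xs ++ g ∷ []) Ys
  same {u} {v} u≢v = trans (parity-++ Xs (g ∷ []) u v)
    (trans (cong (parity Xs u v xor_) (BoolP.xor-identityʳ (bothIn g u v))) (sym (eq u≢v)))

xorSum-pairs-all : (X : Subset n) {u v : Fin n} → u ≢ v →
                   xorSum (λ (a , b) → bothIn (pair a b) u v) (pairs X) ≡ bothIn X u v
xorSum-pairs-all X {u} {v} u≢v =
  trans (xorSum-cong (pairs X) (λ _ → sym (BoolP.∧-identityʳ _)))
    (trans (xorSum-pairs (λ _ _ → true) X u≢v)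
      (trans (cong (bothIn X u v ∧_) (if-same (toℕ u ℕ.<ᵇ toℕ v) true)) (BoolP.∧-identityʳ _)))

module Replacement {p : ℕ} (4≤p : 4 ≤ p) (p-even : odd p ≡ false) (2+p≤n : 2 + p ≤ n)
                   {t s : Fin n} (t≢s : t ≢ s) where

  bound : ℕ
  bound = (4 * p ∸ 4) * (p C 2)

  ReplacedBy : List (Subset n) → List (Subset n) → ℕ → Set
  ReplacedBy Xs Ys ℓ = All (λ Y → ∣ Y ∣ ≡ p) Ys × length Ys ≤ ℓ × ParityModulo (pair t s) Ys Xs

  private
    2≤p : 2 ≤ p
    2≤p = ℕP.≤-trans (s≤s (s≤s z≤n)) 4≤p

  gadgets : Subset n → List (Fin n × Fin n) → List (Subset n)
  gadgets T = concatMap (λ (a , b) → gadget T a b)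

  module _ (T : Subset n) (∣T∣ : ∣ T ∣ ≡ 2 + p) where

    private
      T-even : odd ∣ T ∣ ≡ false
      T-even = trans (cong odd ∣T∣) (trans (BoolP.not-involutive (odd p)) p-even)

    length-gadgets : ∀ qs → All (PairIn T) qs → length (gadgets T qs) ≡ length qs * suc (suc p + suc p)
    length-gadgets []       []                         = refl
    length-gadgets (_ ∷ qs) ((a≢b , a∈T , b∈T) ∷ qs⊆T) =
      trans (ListP.length-++ (gadget T _ _)) (cong₂ _+_ (length-gadget T a≢b a∈T b∈T ∣T∣) (length-gadgets qs qs⊆T))

    gadgets-length≤ : ∀ qs → All (PairIn T) qs → length qs ≤ p C 2 → length (gadgets T qs) ≤ bound
    gadgets-length≤ qs qs⊆T ≤C2 = begin
      length (gadgets T qs)               ≡⟨ length-gadgets qs qs⊆T ⟩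
      length qs * suc (suc p + suc p)   ≤⟨ ℕP.*-mono-≤ ≤C2 (gadget-length≤ 4≤p) ⟩
      (p C 2) * (4 * p ∸ 4)             ≡⟨ ℕP.*-comm (p C 2) _ ⟩
      bound                             ∎
      where open ℕP.≤-Reasoning

    -- With an even number of gadgets the copies of K(T) cancel.
    gadgets-replace : (X : Subset n) (qs : List (Fin n × Fin n)) → All (PairIn T) qs →
                      odd (length qs) ≡ false → length qs ≤ p C 2 → (b : Bool) →
                      (∀ {u v} → u ≢ v → xorSum (λ (a , b) → bothIn (pair a b) u v) qs ≡
                                           bothIn X u v xor (b ∧ bothIn (pair t s) u v)) →
                      ReplacedBy (X ∷ []) (gadgets T qs) bound
    gadgets-replace X qs qs⊆T even ≤C2 b sum =
      AllP.concat⁺ (AllP.map⁺ (All.map (λ (a≢b , a∈T , b∈T) → gadget-size T a≢b a∈T b∈T ∣T∣) qs⊆T)) ,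
      gadgets-length≤ qs qs⊆T ≤C2 ,
      b , λ {u} {v} u≢v → begin
        parity (gadgets T qs) u v
          ≡⟨ parity-concatMap _ qs u v ⟩
        xorSum (λ (a , b) → parity (gadget T a b) u v) qs
          ≡⟨ xorSum-congᴬ qs⊆T (λ (a≢b , a∈T , b∈T) → parity-gadget T a≢b a∈T b∈T T-even u≢v) ⟩
        xorSum (λ (a , b) → bothIn T u v xor bothIn (pair a b) u v) qs
          ≡⟨ xorSum-xor _ _ qs ⟩
        xorSum (λ _ → bothIn T u v) qs xor xorSum (λ (a , b) → bothIn (pair a b) u v) qs
          ≡⟨ cong₂ _xor_ (trans (xorSum-const _ qs) (cong (bothIn T u v ∧_) even)) (sum u≢v) ⟩
        bothIn T u v ∧ false xor (bothIn X u v xor b ∧ bothIn (pair t s) u v)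
          ≡⟨ cong (_xor (bothIn X u v xor b ∧ bothIn (pair t s) u v)) (BoolP.∧-zeroʳ (bothIn T u v)) ⟩
        bothIn X u v xor b ∧ bothIn (pair t s) u v
          ≡⟨ cong (_xor b ∧ bothIn (pair t s) u v) (BoolP.xor-identityʳ (bothIn X u v)) ⟨
        (bothIn X u v xor false) xor b ∧ bothIn (pair t s) u v ∎
      where
      open ≡-Reasoning


  module _ (X T : Subset n) (X∪ts⊆T : ∀ w → lookup (X ∪ pair t s) w ≡ true → lookup T w ≡ true)
           (∣T∣ : ∣ T ∣ ≡ 2 + p) (∣X∣<p : ∣ X ∣ < p) where

    private
      X⊆T : ∀ {w} → lookup X w ≡ true → lookup T w ≡ true
      X⊆T {w} w∈X = X∪ts⊆T w (trans (lookup-∪ X (pair t s) w) (cong (_∨ lookup (pair t s) w) w∈X))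

      ts⊆T : ∀ {w} → lookup (pair t s) w ≡ true → lookup T w ≡ true
      ts⊆T {w} w∈ts = X∪ts⊆T w (trans (lookup-∪ X (pair t s) w)
                                      (trans (cong (lookup X w ∨_) w∈ts) (BoolP.∨-zeroʳ _)))

      pairsX⊆T : All (PairIn T) (pairs X)
      pairsX⊆T = All.map (λ (a≢b , a∈X , b∈X) → a≢b , X⊆T a∈X , X⊆T b∈X) (pairs-in X)

      ∣pairs∣< : suc (length (pairs X)) ≤ p C 2
      ∣pairs∣< = subst (λ k → suc k ≤ p C 2) (sym (length-pairs X)) (C2-< ∣X∣<p 2≤p)

    replace-inside : Σ (List (Subset n)) λ Ys → ReplacedBy (X ∷ []) Ys bound
    replace-inside with odd (length (pairs X)) in pairs-parity
    ... | false = gadgets T (pairs X) ,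
                  gadgets-replace T ∣T∣ X (pairs X) pairsX⊆T pairs-parity (ℕP.≤-trans (ℕP.n≤1+n _) ∣pairs∣<)
                    false (λ u≢v → trans (xorSum-pairs-all X u≢v) (sym (BoolP.xor-identityʳ _)))
    -- An odd number of pairs is made even with {t, s}, which is then accounted for by b = true.
    ... | true  = gadgets T ((t , s) ∷ pairs X) ,
                  gadgets-replace T ∣T∣ X ((t , s) ∷ pairs X)
                    ((t≢s , ts⊆T (∈pairˡ t s) , ts⊆T (∈pairʳ t s)) ∷ pairsX⊆T) (cong not pairs-parity) ∣pairs∣<
                    true (λ {u} {v} u≢v → trans (cong (bothIn (pair t s) u v xor_) (xorSum-pairs-all X u≢v))
                                                (BoolP.xor-comm (bothIn (pair t s) u v) (bothIn X u v)))

  ∣X∪ts∣≤2+p : (X : Subset n) → ∣ X ∣ < p → ∣ X ∪ pair t s ∣ ≤ 2 + p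
  ∣X∪ts∣≤2+p X ∣X∣<p = begin
    ∣ X ∪ pair t s ∣          ≤⟨ ∣p∪q∣≤∣p∣+∣q∣ X (pair t s) ⟩
    ∣ X ∣ + ∣ pair t s ∣      ≤⟨ ℕP.+-mono-≤ (ℕP.<⇒≤ ∣X∣<p) (∣pair∣≤2 t s) ⟩
    p + 2                     ≡⟨ ℕP.+-comm p 2 ⟩
    2 + p                     ∎
    where open ℕP.≤-Reasoning

  replace-small : (X : Subset n) → ∣ X ∣ < p → Σ (List (Subset n)) λ Ys → ReplacedBy (X ∷ []) Ys bound
  replace-small X ∣X∣<p with superset-of-size (X ∪ pair t s) (2 + p) (∣X∪ts∣≤2+p X ∣X∣<p) 2+p≤n
  ... | T , X∪ts⊆T , ∣T∣ = replace-inside X T X∪ts⊆T ∣T∣ ∣X∣<p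

  replace-one : (X : Subset n) → ∣ X ∣ ≤ p → Σ (List (Subset n)) λ Ys → ReplacedBy (X ∷ []) Ys bound
  replace-one X ∣X∣≤p with ∣ X ∣ ℕ.≟ p
  ... | yes ∣X∣≡p = X ∷ [] , ∣X∣≡p ∷ [] , 1≤bound , false , λ _ → sym (BoolP.xor-identityʳ _)
    where
    1≤bound : 1 ≤ bound
    1≤bound = ℕP.*-mono-≤ {1} {4 * p ∸ 4} {1} {p C 2}
                (ℕP.≤-trans (s≤s z≤n) (gadget-length≤ 4≤p)) (C2-< (ℕP.≤-trans (s≤s z≤n) 2≤p) 2≤p)
  ... | no ∣X∣≢p = replace-small X (ℕP.≤∧≢⇒< ∣X∣≤p ∣X∣≢p)

  replace-all : (Xs : List (Subset n)) → All (λ X → ∣ X ∣ ≤ p) Xs →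
                Σ (List (Subset n)) λ Ys → ReplacedBy Xs Ys (length Xs * bound)
  replace-all []       []               = [] , [] , z≤n , false , λ _ → refl
  replace-all (X ∷ Xs) (∣X∣≤p ∷ ∣Xs∣≤p) with replace-one X ∣X∣≤p | replace-all Xs ∣Xs∣≤p
  ... | Ys , Ys-sizes , Ys-length , Ys≈X | Ys′ , Ys′-sizes , Ys′-length , Ys′≈Xs =
    Ys ++ Ys′ , AllP.++⁺ Ys-sizes Ys′-sizes ,
    ℕP.≤-trans (ℕP.≤-reflexive (ListP.length-++ Ys)) (ℕP.+-mono-≤ Ys-length Ys′-length) ,
    parityModulo-++ {g = pair t s} {Ys = Ys} {X ∷ []} {Ys′} {Xs} Ys≈X Ys′≈Xs

corollary1p9 : (p : ℕ) → 4 ≤ p → 2 ∣ p →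
    (n : ℕ) → p + 2 ≤ n → (D : Digraph n) → IsOriented D → DirectedCycle D →
    Σ ℕ λ a → Σ ℕ λ b → IsInvLe p D a × IsInvEq p D b ×
      a ≤ b × b ≤ ((4 * p ∸ 4) * (p C 2)) * a
corollary1p9 p 4≤p (divides q p≡q*2) n p+2≤n D oriented _ =
  let a , inv≤ = minInv-exists (λ X → ∣ X ∣ ℕ.≤? p)
                   (sorting-solution oriented (ℕP.≤-trans (s≤s (s≤s z≤n)) 4≤p))
      (Xs , ∣Xs∣≡a , Xs-sizes , Xs-acyclic) , a-least = inv≤
      t , s , t≢s , flip-acyclic = safe-pair (ℕP.≤-trans (ℕP.m≤n+m 2 p) p+2≤n) Xs-acyclic
      Ys , Ys-sizes , Ys-length , Ys≈Xs = Replacement.replace-all 4≤p p-even 2+p≤n t≢s Xs Xs-sizes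
      Ys-solution = Ys , refl , Ys-sizes ,
                    acyclic-parityModulo {g = pair t s} {Ys} {Xs} D Ys≈Xs Xs-acyclic flip-acyclic
      b , inv= = minInv-exists (λ X → ∣ X ∣ ℕ.≟ p) Ys-solution
  in a , b , inv≤ , inv= , a-least b (solvableWith-mono ℕP.≤-reflexive (proj₁ inv=)) ,
     ℕP.≤-trans (proj₂ inv= _ Ys-solution)
       (ℕP.≤-trans Ys-length (ℕP.≤-reflexive (trans (cong (_* _) ∣Xs∣≡a) (ℕP.*-comm a _))))
  where
  p-even : odd p ≡ false
  p-even = subst (λ m → odd m ≡ false) (sym p≡q*2) (odd-*2 q)
  2+p≤n : 2 + p ≤ n
  2+p≤n = subst (_≤ n) (ℕP.+-comm p 2) p+2≤n
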